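{- There exist a circuit $c$ and an initial state $st_0$ such that the desynchronization marked graph $DS_c$ does not ensure flow equivalence of $c$ with initial state $st_0$; that is, there exist a latch $l$, a trace $t$ with $DS_c\vdash t\Downarrow m$ for some marking $m$, and a value $v$ such that $\mathrm{transp}(t,l)=\mathrm{Opaque}$, $\langle c,st_0\rangle\vdash t\downarrow l\mapsto v$, and $v\neq \mathrm{sync}(c,st_0,\mathrm{num}(l-,t))(l)$.
   Context: A value is either $\mathrm{Num}(n)$ with $n\in\mathbb N$ or the undefined value $X$. A circuit $c$ consists of: a set of even latches and a set of odd latches (the latches of $c$ are their disjoint union); a finite list of pairs $(E,O)$ with $E$ even, $O$ odd, and a finite list of pairs $(O,E)$ with $O$ odd, $E$ even, where a pair $(l,l')$ in either list means $l$ is a left neighbor of $l'$ (and $l'$ a right neighbor of $l$); and for each latch $l$ a next-state function mapping an assignment of values to the left neighbors of $l$ to a value. A state is a function from latches to values; $\mathrm{next}_c(st,l)$ denotes the next-state function of $l$ applied to the restriction of $st$ to the left neighbors of $l$. Synchronous execution: $\mathrm{sync}(c,st_0,n)(l)$ equals $st_0(l)$ if $n=0$ and $l$ even; $X$ if $n=0$ and $l$ odd; $\mathrm{next}_c(\mathrm{sync}(c,st_0,n),l)$ if $n>0$ and $l$ even; $\mathrm{next}_c(\mathrm{sync}(c,st_0,n-1),l)$ if $n>0$ and $l$ odd. Events are $l+$ (rise of the clock of latch $l$) and $l-$ (fall). A trace is a finite sequence of events; $\varepsilon$ is the empty trace and $t\triangleright e$ is $t$ extended by event $e$ as its most recent event.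 $\mathrm{num}(e,t)$ is the number of occurrences of $e$ in $t$. Transparency: $\mathrm{transp}(\varepsilon,l)=\mathrm{Transparent}$ if $l$ odd, $\mathrm{Opaque}$ if $l$ even; $\mathrm{transp}(t\triangleright l+,l)=\mathrm{Transparent}$; $\mathrm{transp}(t\triangleright l-,l)=\mathrm{Opaque}$; $\mathrm{transp}(t\triangleright e,l)=\mathrm{transp}(t,l)$ for other events $e$. Asynchronous execution: $\langle c,st_0\rangle\vdash t\downarrow l\mapsto v$ is the smallest relation on (trace, latch, value) closed under: (1) if $\mathrm{transp}(t,l)=\mathrm{Transparent}$ and $st$ is a state such that $\langle c,st_0\rangle\vdash t\downarrow l'\mapsto st(l')$ for every left neighbor $l'$ of $l$, then $\langle c,st_0\rangle\vdash t\downarrow l\mapsto \mathrm{next}_c(st,l)$; (2) for every even $l$, $\langle c,st_0\rangle\vdash \varepsilon\downarrow l\mapsto st_0(l)$; (3) if $\mathrm{transp}(t'\triangleright e,l)=\mathrm{Opaque}$, $e\neq l-$, and $\langle c,st_0\rangle\vdash t'\downarrow l\mapsto v$ with $\mathrm{transp}(t',l)=\mathrm{Opaque}$, then $\langle c,st_0\rangle\vdash t'\triangleright e\downarrow l\mapsto v$; (4) if $st$ is a state with $\langle c,st_0\rangle\vdash t'\downarrow l'\mapsto st(l')$ for every left neighbor $l'$ of $l$, then $\langle c,st_0\rangle\vdash t'\triangleright l-\downarrow l\mapsto \mathrm{next}_c(st,l)$. A marked graph over the set of events consists of a set of places, each with a unique input event and a unique output event, and an initial marking $m_0$ (places $\to\mathbb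 N$). An event $e$ is enabled in a marking $m$ if $m(p)>0$ for every place $p$ with output event $e$; firing $e$ yields $m'$ with $m'(p)=m(p)-1$ if $p$'s output event is $e$, $m(p)+1$ if $p$'s input event is $e$, $m(p)$ otherwise. $M\vdash t\Downarrow m$ is defined inductively: $M\vdash\varepsilon\Downarrow m_0$; if $M\vdash t'\Downarrow m'$ and $e$ is enabled in $m'$, then $M\vdash t'\triangleright e\Downarrow m$ with $m$ the result of firing $e$ in $m'$. A marked graph $M$ ensures flow equivalence of $c$ with initial state $st_0$ if for all latches $l$, traces $t$ and values $v$: if $M\vdash t\Downarrow m$ for some $m$, $\mathrm{transp}(t,l)=\mathrm{Opaque}$ and $\langle c,st_0\rangle\vdash t\downarrow l\mapsto v$, then $v=\mathrm{sync}(c,st_0,\mathrm{num}(l-,t))(l)$. The desynchronization marked graph $DS_c$ has places (input $\to$ output) with initial markings: for each latch $l$, a place $l+\to l-$ with initial marking $1$ if $l$ odd, $0$ if $l$ even, and a place $l-\to l+$ with initial marking $1$ if $l$ even, $0$ if $l$ odd; for each neighbor pair $(l,l')$ ($l$ a left neighbor of $l'$), a place $l+\to l'-$ with initial marking $1$, and a place $l'-\to l+$ with initial marking $0$. -}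

module Defs where

open import Data.Nat using (ℕ; zero; suc; _∸_; _+_; _<_)
open import Data.Product using (_×_; _,_; Σ)
open import Data.Sum using (_⊎_; inj₁; inj₂)
open import Data.List using (List)
open import Data.List.Membership.Propositional using (_∈_)
open import Data.Empty using (⊥)
open import Relation.Nullary using (does; ¬_)
open import Relation.Binary.Definitions using (DecidableEquality)
open import Relation.Binary.PropositionalEquality using (_≡_; refl; cong)
open import Data.Bool using (if_then_else_)

data Value : Set where
  Num : ℕ → Value
  X   : Value

record Shape : Set₁ where
  field
    Even Odd : Set
    _≟E_     : DecidableEquality Even
    _≟O_     : DecidableEquality Odd
    eoPairs  : List (Even × Odd)   -- (E , O) : E is a left neighbour of O
    oePairs  : List (Odd × Even)   -- (O , E) : O is a left neighbour of E

  Latch : Set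
  Latch = Even ⊎ Odd

open Shape public using (Latch)

-- LeftNb s l' l : l' is a left neighbour of l
LeftNb : (s : Shape) → Latch s → Latch s → Set
LeftNb s (inj₁ e) (inj₂ o) = (e , o) ∈ Shape.eoPairs s
LeftNb s (inj₂ o) (inj₁ e) = (o , e) ∈ Shape.oePairs s
LeftNb s (inj₁ _) (inj₁ _) = ⊥
LeftNb s (inj₂ _) (inj₂ _) = ⊥

Assignment : (s : Shape) → Latch s → Set
Assignment s l = (l' : Latch s) → LeftNb s l' l → Value

record Circuit : Set₁ where
  field
    shape : Shape
    nextFn : (l : Latch shape) → Assignment shape l → Value

open Circuit public

LatchOf : Circuit → Set
LatchOf c = Latch (shape c)

IsEven IsOdd : {c : Circuit} → LatchOf c → Set
IsEven (inj₁ _) = Data.Unit.⊤ where import Data.Unit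
IsEven (inj₂ _) = ⊥
IsOdd  (inj₁ _) = ⊥
IsOdd  (inj₂ _) = Data.Unit.⊤ where import Data.Unit

_≟L_ : {c : Circuit} → DecidableEquality (LatchOf c)
_≟L_ {c} = Data.Sum.Properties.≡-dec (Shape._≟E_ (shape c)) (Shape._≟O_ (shape c))
  where import Data.Sum.Properties

State : Circuit → Set
State c = LatchOf c → Value

next : (c : Circuit) → State c → LatchOf c → Value
next c st l = nextFn c l (λ l' _ → st l')

-- sync c st0 n (even l) = next_c (sync c st0 n) l   (n > 0); only the odd
-- latches (the left neighbours of an even latch) at step n are consulted,
-- which is why the definition is split into an even and an odd part.

module _ (c : Circuit) (st0 : State c) where
  private
    s = shape c
    E = Shape.Even s
    O = Shape.Odd s

  fromEven : (E → Value) → (o : O) → Assignment s (inj₂ o)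
  fromEven f o (inj₁ e) _ = f e
  fromEven f o (inj₂ _) ()

  fromOdd : (O → Value) → (e : E) → Assignment s (inj₁ e)
  fromOdd f e (inj₂ o) _ = f o
  fromOdd f e (inj₁ _) ()

  oddStep : (E → Value) → O → Value
  oddStep f o = nextFn c (inj₂ o) (fromEven f o)

  evenStep : (O → Value) → E → Value
  evenStep f e = nextFn c (inj₁ e) (fromOdd f e)

  syncE : ℕ → E → Value
  syncE zero    e = st0 (inj₁ e)
  syncE (suc n) e = evenStep (oddStep (syncE n)) e

  syncO : ℕ → O → Value
  syncO zero    o = X
  syncO (suc n) o = oddStep (syncE n) o

sync : (c : Circuit) → State c → ℕ → State c
sync c st0 n (inj₁ e) = syncE c st0 n e
sync c st0 n (inj₂ o) = syncO c st0 n o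

data Event (c : Circuit) : Set where
  _⁺ : LatchOf c → Event c    -- l+ : rise of the clock of l
  _⁻ : LatchOf c → Event c    -- l- : fall of the clock of l

_≟Ev_ : {c : Circuit} → DecidableEquality (Event c)
_≟Ev_ {c} (l ⁺) (l' ⁺) with _≟L_ {c} l l'
... | Relation.Nullary.yes refl = Relation.Nullary.yes refl
... | Relation.Nullary.no  ne   = Relation.Nullary.no λ { refl → ne refl }
_≟Ev_ {c} (l ⁻) (l' ⁻) with _≟L_ {c} l l'
... | Relation.Nullary.yes refl = Relation.Nullary.yes refl
... | Relation.Nullary.no  ne   = Relation.Nullary.no λ { refl → ne refl }
_≟Ev_ (l ⁺) (l' ⁻) = Relation.Nullary.no λ ()
_≟Ev_ (l ⁻) (l' ⁺) = Relation.Nullary.no λ ()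

-- traces; t ▷ e has e as its most recent event
data Trace (c : Circuit) : Set where
  ε   : Trace c
  _▷_ : Trace c → Event c → Trace c

infixl 5 _▷_

num : {c : Circuit} → Event c → Trace c → ℕ
num e ε = zero
num {c} e (t ▷ e') = if does (_≟Ev_ {c} e' e) then suc (num e t) else num e t

data Transparency : Set where
  Transparent Opaque : Transparency

transp : {c : Circuit} → Trace c → LatchOf c → Transparency
transp ε (inj₁ _) = Opaque
transp ε (inj₂ _) = Transparent
transp {c} (t ▷ e) l =
  if does (_≟Ev_ {c} e (l ⁺)) then Transparent
  else if does (_≟Ev_ {c} e (l ⁻)) then Opaque
  else transp t l

data ⟨_,_⟩⊢_↓_↦_ (c : Circuit) (st0 : State c) : Trace c → LatchOf c → Value → Set where
  rule1 : ∀ {t l} (st : State c) →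
          transp t l ≡ Transparent →
          (∀ l' → LeftNb (shape c) l' l → ⟨ c , st0 ⟩⊢ t ↓ l' ↦ st l') →
          ⟨ c , st0 ⟩⊢ t ↓ l ↦ next c st l
  rule2 : ∀ e → ⟨ c , st0 ⟩⊢ ε ↓ inj₁ e ↦ st0 (inj₁ e)
  rule3 : ∀ {t' e l v} →
          transp (t' ▷ e) l ≡ Opaque →
          ¬ (e ≡ l ⁻) →
          ⟨ c , st0 ⟩⊢ t' ↓ l ↦ v →
          transp t' l ≡ Opaque →
          ⟨ c , st0 ⟩⊢ t' ▷ e ↓ l ↦ v
  rule4 : ∀ {t' l} (st : State c) →
          (∀ l' → LeftNb (shape c) l' l → ⟨ c , st0 ⟩⊢ t' ↓ l' ↦ st l') →
          ⟨ c , st0 ⟩⊢ t' ▷ (l ⁻) ↓ l ↦ next c st l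

record MarkedGraph (c : Circuit) : Set₁ where
  field
    Place  : Set
    input  : Place → Event c
    output : Place → Event c
    m₀     : Place → ℕ

  Marking : Set
  Marking = Place → ℕ

  Enabled : Marking → Event c → Set
  Enabled m e = ∀ p → output p ≡ e → 0 < m p

  fire : Marking → Event c → Marking
  fire m e p =
    if does (_≟Ev_ {c} (output p) e) then m p ∸ 1
    else if does (_≟Ev_ {c} (input p) e) then m p + 1
    else m p

data _⊢_⇓_ {c : Circuit} (M : MarkedGraph c) : Trace c → MarkedGraph.Marking M → Set where
  init : M ⊢ ε ⇓ MarkedGraph.m₀ M
  step : ∀ {t' m' e} → M ⊢ t' ⇓ m' → MarkedGraph.Enabled M m' e →
         M ⊢ t' ▷ e ⇓ MarkedGraph.fire M m' e

EnsuresFlowEquivalence : (c : Circuit) → MarkedGraph c → State c → Set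
EnsuresFlowEquivalence c M st0 =
  ∀ (l : LatchOf c) (t : Trace c) (v : Value) →
  Σ (MarkedGraph.Marking M) (λ m → M ⊢ t ⇓ m) →
  transp t l ≡ Opaque →
  ⟨ c , st0 ⟩⊢ t ↓ l ↦ v →
  v ≡ sync c st0 (num (l ⁻) t) l

data DSPlace (c : Circuit) : Set where
  pm   : LatchOf c → DSPlace c
  mp   : LatchOf c → DSPlace c
  nbPM : (l l' : LatchOf c) → LeftNb (shape c) l l' → DSPlace c
  nbMP : (l l' : LatchOf c) → LeftNb (shape c) l l' → DSPlace c

DS : (c : Circuit) → MarkedGraph c
DS c = record { Place = DSPlace c ; input = inp ; output = out ; m₀ = m0 }
  where
  inp out : DSPlace c → Event c
  inp (pm l) = l ⁺
  inp (mp l) = l ⁻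
  inp (nbPM l l' _) = l ⁺
  inp (nbMP l l' _) = l' ⁻
  out (pm l) = l ⁻
  out (mp l) = l ⁺
  out (nbPM l l' _) = l' ⁻
  out (nbMP l l' _) = l ⁺
  m0 : DSPlace c → ℕ
  m0 (pm (inj₁ _)) = 0
  m0 (pm (inj₂ _)) = 1
  m0 (mp (inj₁ _)) = 1
  m0 (mp (inj₂ _)) = 0
  m0 (nbPM _ _ _) = 1
  m0 (nbMP _ _ _) = 0

-- DS_c only makes l⁺ wait for the right neighbours of l, so an even latch may
-- close, reopen and be transparent again while its odd left neighbour is still
-- in its initial transparent phase. In the pipeline ℓ₀ → ℓ₁ → ℓ₂ → ℓ₃ whose
-- source ℓ₀ computes 1 (all latches start at 0), ℓ₀ and ℓ₁ never clock in the
-- trace below; ℓ₂ reopens and sees ℓ₀'s initial 0 through the transparent ℓ₁,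
-- and ℓ₃ closes for the third time on that 0. Synchronously ℓ₃ after three
-- cycles holds ℓ₀ after one cycle, which is 1.
module Submission where

open import Defs
open import Data.Bool using (Bool; false; true)
open import Data.Bool.Properties using () renaming (_≟_ to _≟B_)
open import Data.Empty using (⊥-elim)
open import Data.List using (_∷_; [])
open import Data.List.Relation.Unary.Any using (here; there)
open import Data.Nat using (_<_; z<s)
open import Data.Product using (Σ; _×_; _,_; proj₁; proj₂)
open import Data.Sum using (inj₁; inj₂)
open import Relation.Nullary using (¬_; yes; no)
open import Relation.Nullary.Decidable using (dec-false)
open import Relation.Binary.PropositionalEquality using (_≡_; refl; trans)

open MarkedGraph using (Marking; Enabled; fire)

elim-unique : {A : Set} {B : A → Set} {k : A} → (∀ a → B a → a ≡ k) →
              {P : ∀ a → B a → Set} → (∀ b → P k b) → ∀ a b → P a b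
elim-unique unique pk a b with unique a b
... | refl = pk b

module _ {c : Circuit} where

  DS-enabled⁻ : ∀ {m : Marking (DS c)} {l} →
                0 < m (pm l) → (∀ l' n → 0 < m (nbPM l' l n)) →
                Enabled (DS c) m (l ⁻)
  DS-enabled⁻ own left (pm _)         refl = own
  DS-enabled⁻ own left (nbPM l' _ n)  refl = left l' n
  DS-enabled⁻ own left (mp _)         ()
  DS-enabled⁻ own left (nbMP _ _ _)   ()

  DS-enabled⁺ : ∀ {m : Marking (DS c)} {l} →
                0 < m (mp l) → (∀ l' n → 0 < m (nbMP l l' n)) →
                Enabled (DS c) m (l ⁺)
  DS-enabled⁺ own right (mp _)         refl = own
  DS-enabled⁺ own right (nbMP _ l' n)  refl = right l' n
  DS-enabled⁺ own right (pm _)         ()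
  DS-enabled⁺ own right (nbPM _ _ _)   ()

  transp-▷-other : ∀ {e l} (t : Trace c) → ¬ e ≡ l ⁺ → ¬ e ≡ l ⁻ → transp (t ▷ e) l ≡ transp t l
  transp-▷-other {e} {l} t e≢l⁺ e≢l⁻
    rewrite dec-false (_≟Ev_ {c} e (l ⁺)) e≢l⁺ | dec-false (_≟Ev_ {c} e (l ⁻)) e≢l⁻ = refl

  num-▷-≡0 : ∀ {e e'} t → num e (t ▷ e') ≡ 0 → ¬ e' ≡ e × num e t ≡ 0
  num-▷-≡0 {e} {e'} t n≡0 with _≟Ev_ {c} e' e
  num-▷-≡0 t ()  | yes _
  num-▷-≡0 t n≡0 | no e'≢e = e'≢e , n≡0

  Unclocked : LatchOf c → Trace c → Set
  Unclocked l t = num (l ⁺) t ≡ 0 × num (l ⁻) t ≡ 0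

  unclocked-▷ : ∀ {l t e} → Unclocked l (t ▷ e) → ¬ e ≡ l ⁺ × ¬ e ≡ l ⁻ × Unclocked l t
  unclocked-▷ {l} {t} {e} (rises , falls) with num-▷-≡0 {l ⁺} {e} t rises | num-▷-≡0 {l ⁻} {e} t falls
  ... | e≢l⁺ , rises′ | e≢l⁻ , falls′ = e≢l⁺ , e≢l⁻ , rises′ , falls′

  transp-unclocked : ∀ {l} (t : Trace c) → Unclocked l t → transp t l ≡ transp {c} ε l
  transp-unclocked ε       _ = refl
  transp-unclocked {l} (t ▷ e) u with unclocked-▷ {l} {t} {e} u
  ... | e≢l⁺ , e≢l⁻ , u′ = trans (transp-▷-other t e≢l⁺ e≢l⁻) (transp-unclocked t u′)

  module _ {st₀ : State c} where

    unclocked-even-initial : ∀ {e} t → Unclocked (inj₁ e) t →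
                             ⟨ c , st₀ ⟩⊢ t ↓ inj₁ e ↦ st₀ (inj₁ e)
    unclocked-even-initial ε       _ = rule2 _
    unclocked-even-initial {e} (t ▷ e') u with unclocked-▷ {inj₁ e} {t} {e'} u
    ... | e≢l⁺ , e≢l⁻ , u′ =
      rule3 (transp-unclocked (t ▷ e') u) e≢l⁻
            (unclocked-even-initial t u′) (transp-unclocked t u′)

    transparent-single-input : ∀ {t l k v} → transp t l ≡ Transparent →
                               (∀ l' → LeftNb (shape c) l' l → l' ≡ k) →
                               ⟨ c , st₀ ⟩⊢ t ↓ k ↦ v →
                               ⟨ c , st₀ ⟩⊢ t ↓ l ↦ next c (λ _ → v) l
    transparent-single-input transparent input k↦v =
      rule1 _ transparent (elim-unique input (λ _ → k↦v))

    closing-single-input : ∀ {t l k v} →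
                           (∀ l' → LeftNb (shape c) l' l → l' ≡ k) →
                           ⟨ c , st₀ ⟩⊢ t ↓ k ↦ v →
                           ⟨ c , st₀ ⟩⊢ t ▷ (l ⁻) ↓ l ↦ next c (λ _ → v) l
    closing-single-input input k↦v = rule4 _ (elim-unique input (λ _ → k↦v))

pattern ℓ₀ = inj₁ false
pattern ℓ₁ = inj₂ false
pattern ℓ₂ = inj₁ true
pattern ℓ₃ = inj₂ true

pipelineShape : Shape
pipelineShape = record
  { Even = Bool ; Odd = Bool ; _≟E_ = _≟B_ ; _≟O_ = _≟B_
  ; eoPairs = (false , false) ∷ (true , true) ∷ []
  ; oePairs = (false , true) ∷ []
  }

pipelineNext : (l : Latch pipelineShape) → Assignment pipelineShape l → Value
pipelineNext ℓ₀ _ = Num 1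
pipelineNext ℓ₁ a = a ℓ₀ (here refl)
pipelineNext ℓ₂ a = a ℓ₁ (here refl)
pipelineNext ℓ₃ a = a ℓ₂ (there (here refl))

pipeline : Circuit
pipeline = record { shape = pipelineShape ; nextFn = pipelineNext }

ℓ₁-input : ∀ l → LeftNb pipelineShape l ℓ₁ → l ≡ ℓ₀
ℓ₁-input ℓ₀ _                          = refl
ℓ₁-input ℓ₂ (here ())
ℓ₁-input ℓ₂ (there (here ()))
ℓ₁-input ℓ₂ (there (there ()))
ℓ₁-input (inj₂ _) ()

ℓ₂-input : ∀ l → LeftNb pipelineShape l ℓ₂ → l ≡ ℓ₁
ℓ₂-input ℓ₁ _                  = refl
ℓ₂-input ℓ₃ (here ())
ℓ₂-input ℓ₃ (there ())
ℓ₂-input (inj₁ _) ()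

ℓ₃-input : ∀ l → LeftNb pipelineShape l ℓ₃ → l ≡ ℓ₂
ℓ₃-input ℓ₂ _                          = refl
ℓ₃-input ℓ₀ (here ())
ℓ₃-input ℓ₀ (there (here ()))
ℓ₃-input ℓ₀ (there (there ()))
ℓ₃-input (inj₂ _) ()

ℓ₂-output : ∀ l → LeftNb pipelineShape ℓ₂ l → l ≡ ℓ₃
ℓ₂-output ℓ₃ _                          = refl
ℓ₂-output ℓ₁ (here ())
ℓ₂-output ℓ₁ (there (here ()))
ℓ₂-output ℓ₁ (there (there ()))
ℓ₂-output (inj₁ _) ()

ℓ₃-no-output : ∀ l → ¬ LeftNb pipelineShape ℓ₃ l
ℓ₃-no-output ℓ₀ (here ())
ℓ₃-no-output ℓ₀ (there ())
ℓ₃-no-output ℓ₂ (here ())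
ℓ₃-no-output ℓ₂ (there ())
ℓ₃-no-output (inj₂ _) ()

module _ {m : Marking (DS pipeline)} where

  ℓ₂⁺-enabled : 0 < m (mp ℓ₂) → (∀ n → 0 < m (nbMP ℓ₂ ℓ₃ n)) → Enabled (DS pipeline) m (ℓ₂ ⁺)
  ℓ₂⁺-enabled own right = DS-enabled⁺ own (elim-unique ℓ₂-output right)

  ℓ₂⁻-enabled : 0 < m (pm ℓ₂) → (∀ n → 0 < m (nbPM ℓ₁ ℓ₂ n)) → Enabled (DS pipeline) m (ℓ₂ ⁻)
  ℓ₂⁻-enabled own left = DS-enabled⁻ own (elim-unique ℓ₂-input left)

  ℓ₃⁺-enabled : 0 < m (mp ℓ₃) → Enabled (DS pipeline) m (ℓ₃ ⁺)
  ℓ₃⁺-enabled own = DS-enabled⁺ own λ l n → ⊥-elim (ℓ₃-no-output l n)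

  ℓ₃⁻-enabled : 0 < m (pm ℓ₃) → (∀ n → 0 < m (nbPM ℓ₂ ℓ₃ n)) → Enabled (DS pipeline) m (ℓ₃ ⁻)
  ℓ₃⁻-enabled own left = DS-enabled⁻ own (elim-unique ℓ₃-input left)

st₀ : State pipeline
st₀ _ = Num 0

run : Trace pipeline
run = ε ▷ ℓ₃ ⁻ ▷ ℓ₃ ⁺ ▷ ℓ₂ ⁺ ▷ ℓ₂ ⁻ ▷ ℓ₃ ⁻ ▷ ℓ₃ ⁺ ▷ ℓ₂ ⁺ ▷ ℓ₃ ⁻

run-fireable : Σ (Marking (DS pipeline)) (DS pipeline ⊢ run ⇓_)
run-fireable = _ ,
  init ↠ ℓ₃⁻-enabled z<s (λ _ → z<s)
       ↠ ℓ₃⁺-enabled z<s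
       ↠ ℓ₂⁺-enabled z<s (λ _ → z<s)
       ↠ ℓ₂⁻-enabled z<s (λ _ → z<s)
       ↠ ℓ₃⁻-enabled z<s (λ _ → z<s)
       ↠ ℓ₃⁺-enabled z<s
       ↠ ℓ₂⁺-enabled z<s (λ _ → z<s)
       ↠ ℓ₃⁻-enabled z<s (λ _ → z<s)
  where
  infixl 5 _↠_
  _↠_ : ∀ {t m e} → DS pipeline ⊢ t ⇓ m → Enabled (DS pipeline) m e →
        DS pipeline ⊢ t ▷ e ⇓ fire (DS pipeline) m e
  _↠_ = step

ℓ₃-captures-initial : ⟨ pipeline , st₀ ⟩⊢ run ↓ ℓ₃ ↦ Num 0
ℓ₃-captures-initial =
  closing-single-input ℓ₃-input
    (transparent-single-input refl ℓ₂-input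
      (transparent-single-input refl ℓ₁-input
        (unclocked-even-initial _ (refl , refl))))

ℓ₃-synchronous : sync pipeline st₀ (num (ℓ₃ ⁻) run) ℓ₃ ≡ Num 1
ℓ₃-synchronous = refl

theorem3 : Σ Circuit λ c → Σ (State c) λ st0 →
             Σ (LatchOf c) λ l → Σ (Trace c) λ t → Σ (MarkedGraph.Marking (DS c)) λ m → Σ Value λ v →
               (DS c ⊢ t ⇓ m) × (transp t l ≡ Opaque) × (⟨ c , st0 ⟩⊢ t ↓ l ↦ v)
                 × ¬ (v ≡ sync c st0 (num (l ⁻) t) l)
theorem3 =
  pipeline , st₀ , ℓ₃ , run , proj₁ run-fireable , Num 0 ,
  proj₂ run-fireable , refl , ℓ₃-captures-initial , initial≢synchronous
  where
  initial≢synchronous : ¬ Num 0 ≡ sync pipeline st₀ (num (ℓ₃ ⁻) run) ℓ₃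
  initial≢synchronous rewrite ℓ₃-synchronous = λ ()
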